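{- Let $\Pi$ be a 3-polygraph with a differential interpretation $\partial$ over a functorial interpretation $\phi$ into an ordered commutative monoid $(M,+,0,\preceq)$. Let $f,g,h,k$ be $2$-paths with $f,g$ parallel and $h,k$ parallel, such that $\phi(f)\le\phi(g)$, $\partial f\preceq\partial g$ and $\partial h\preceq\partial k$. Then for every $i\in\{0,1\}$ such that $f\star_ih$ is defined, $\partial(f\star_ih)\preceq\partial(g\star_ik)$. Moreover, if $M$ is strictly ordered and $\partial f\prec\partial g$ or $\partial h\prec\partial k$, then $\partial(f\star_ih)\prec\partial(g\star_ik)$.
   Context: A 3-polygraph freely generates a strict $3$-category whose $k$-morphisms are $k$-paths, composed by $\star_j$ ($0\le j<k$); $s_1$ is the $1$-source; parallel $2$-paths have the same $1$-source and $1$-target. A functorial interpretation $\phi$ assigns to each $1$-path $u$ with $n$ $1$-cells a nonempty $\phi(u)\subseteq(\mathbb{N}\setminus\{0\})^n$ and to each $2$-path $f:u\Rightarrow v$ a monotone map $\phi(f):\phi(u)\to\phi(v)$ (product order), with $\phi(u\star_0v)=\phi(u)\times\phi(v)$, $\phi(f\star_0g)=\phi(f)\times\phi(g)$, $\phi(f\star_1g)=\phi(g)\circ\phi(f)$, identities to identities. An ordered commutative monoid is an ordered set $(M,\preceq)$ with a commutative monoid structure $(+,0)$ with $+$ monotone in both arguments; strictly ordered if $+$ is strictly monotone in both arguments. A differential interpretation $\partial$ over $\phi$ into $M$ assigns to each $2$-path $f$ a monotone map $\partial f:\phi(s_1f)\to M$ with $\partial(\text{identity})=0$, $\partial(f\star_0g)(x,y)=\partial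 f(x)+\partial g(y)$, $\partial(f\star_1g)=\partial f+\partial g\circ\phi(f)$. Maps are compared pointwise; $\prec$ between maps means pointwise strict inequality. -}

module Defs where

open import Level using (Level; _⊔_) renaming (suc to lsuc; zero to lzero)
open import Data.Nat using (ℕ; zero; suc) renaming (_+_ to _+ℕ_; _≤_ to _≤ℕ_; _<_ to _<ℕ_)
open import Data.Vec using (Vec; []; _∷_; _++_)
open import Data.Vec.Relation.Unary.All using (All)
open import Data.Vec.Relation.Binary.Pointwise.Inductive using (Pointwise)
open import Data.Product using (Σ; _×_; _,_)
open import Function.Bundles using (_⇔_)
open import Relation.Unary using (Pred; _∈_)
open import Relation.Nullary using (¬_)
open import Relation.Binary.Core using (Rel)
open import Relation.Binary.Structures using (IsPartialOrder)
open import Relation.Binary.PropositionalEquality using (_≡_)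
open import Algebra.Structures using (IsCommutativeMonoid)

record OrderedCommutativeMonoid (c ℓ₁ ℓ₂ : Level) : Set (lsuc (c ⊔ ℓ₁ ⊔ ℓ₂)) where
  infix 4 _≈_ _⪯_ _≺_
  infixl 6 _+_
  field
    Carrier             : Set c
    _≈_                 : Rel Carrier ℓ₁
    _⪯_                 : Rel Carrier ℓ₂
    _+_                 : Carrier → Carrier → Carrier
    0#                  : Carrier
    isCommutativeMonoid : IsCommutativeMonoid _≈_ _+_ 0#
    isPartialOrder      : IsPartialOrder _≈_ _⪯_
    +-mono              : ∀ {x y z w} → x ⪯ y → z ⪯ w → x + z ⪯ y + w

  _≺_ : Rel Carrier (ℓ₁ ⊔ ℓ₂)
  x ≺ y = (x ⪯ y) × ¬ (x ≈ y)

StrictlyOrdered : ∀ {c ℓ₁ ℓ₂} → OrderedCommutativeMonoid c ℓ₁ ℓ₂ → Set (c ⊔ ℓ₁ ⊔ ℓ₂)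
StrictlyOrdered M = ∀ {x y z} → x ≺ y → (x + z ≺ y + z) × (z + x ≺ z + y)
  where open OrderedCommutativeMonoid M

record Polygraph1 : Set₁ where
  field
    Cell₀ : Set
    Cell₁ : Cell₀ → Cell₀ → Set
open Polygraph1 public

data Path1 (P : Polygraph1) : ℕ → Cell₀ P → Cell₀ P → Set where
  id₁ : ∀ {a} → Path1 P 0 a a
  _▹_ : ∀ {n a b c} → Cell₁ P a b → Path1 P n b c → Path1 P (suc n) a c

infixr 5 _▹_
infixr 5 _⋆₀¹_

_⋆₀¹_ : ∀ {P n m a b c} → Path1 P n a b → Path1 P m b c → Path1 P (n +ℕ m) a c
id₁ ⋆₀¹ v = v
(x ▹ u) ⋆₀¹ v = x ▹ (u ⋆₀¹ v)

record Polygraph2 : Set₁ where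
  field
    base₁ : Polygraph1
    Cell₂ : ∀ {n m a b} → Path1 base₁ n a b → Path1 base₁ m a b → Set
open Polygraph2 public

-- 2-paths of the free 2-category generated by a 2-polygraph
-- (syntactic composites of generators and identities)
infixl 6 _⋆₀_
infixl 5 _⋆₁_
data Path2 (P : Polygraph2) : ∀ {n m a b} → Path1 (base₁ P) n a b → Path1 (base₁ P) m a b → Set where
  gen  : ∀ {n m a b} {u : Path1 (base₁ P) n a b} {v : Path1 (base₁ P) m a b} →
         Cell₂ P u v → Path2 P u v
  id₂  : ∀ {n a b} (u : Path1 (base₁ P) n a b) → Path2 P u u
  _⋆₁_ : ∀ {n m l a b} {u : Path1 (base₁ P) n a b} {v : Path1 (base₁ P) m a b}
           {w : Path1 (base₁ P) l a b} →
         Path2 P u v → Path2 P v w → Path2 P u w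
  _⋆₀_ : ∀ {n m n' m' a b c} {u : Path1 (base₁ P) n a b} {v : Path1 (base₁ P) m a b}
           {u' : Path1 (base₁ P) n' b c} {v' : Path1 (base₁ P) m' b c} →
         Path2 P u v → Path2 P u' v' → Path2 P (u ⋆₀¹ u') (v ⋆₀¹ v')

record Polygraph3 : Set₁ where
  field
    base₂ : Polygraph2
    Cell₃ : ∀ {n m a b} {u : Path1 (base₁ base₂) n a b} {v : Path1 (base₁ base₂) m a b} →
            Path2 base₂ u v → Path2 base₂ u v → Set
open Polygraph3 public

_≤ᵥ_ : ∀ {n} → Vec ℕ n → Vec ℕ n → Set
_≤ᵥ_ = Pointwise _≤ℕ_

record FunctorialInterpretation (P : Polygraph2) : Set₁ where
  private
    Π1 = Path1 (base₁ P)
  field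
    φ₁          : ∀ {n a b} → Π1 n a b → Pred (Vec ℕ n) lzero
    φ₁-positive : ∀ {n a b} (u : Π1 n a b) (x : Vec ℕ n) → x ∈ φ₁ u → All (λ k → 0 <ℕ k) x
    φ₁-nonempty : ∀ {n a b} (u : Π1 n a b) → Σ (Vec ℕ n) (λ x → x ∈ φ₁ u)
    φ₁-id       : ∀ {a} → [] ∈ φ₁ (id₁ {P = base₁ P} {a = a})
    φ₁-⋆₀       : ∀ {n m a b c} (u : Π1 n a b) (v : Π1 m b c) (x : Vec ℕ n) (y : Vec ℕ m) →
                  ((x ++ y) ∈ φ₁ (u ⋆₀¹ v)) ⇔ ((x ∈ φ₁ u) × (y ∈ φ₁ v))
    -- φ(f) : φ(u) → φ(v), monotone (represented by a function on ℕ^n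
    -- whose restriction to φ(u) is the map)
    φ₂          : ∀ {n m a b} {u : Π1 n a b} {v : Π1 m a b} → Path2 P u v → Vec ℕ n → Vec ℕ m
    φ₂-into     : ∀ {n m a b} {u : Π1 n a b} {v : Π1 m a b} (f : Path2 P u v) (x : Vec ℕ n) →
                  x ∈ φ₁ u → φ₂ f x ∈ φ₁ v
    φ₂-mono     : ∀ {n m a b} {u : Π1 n a b} {v : Π1 m a b} (f : Path2 P u v) (x y : Vec ℕ n) →
                  x ∈ φ₁ u → y ∈ φ₁ u → x ≤ᵥ y → φ₂ f x ≤ᵥ φ₂ f y
    φ₂-id       : ∀ {n a b} (u : Π1 n a b) (x : Vec ℕ n) → x ∈ φ₁ u → φ₂ (id₂ u) x ≡ x
    φ₂-⋆₀       : ∀ {n m n' m' a b c} {u : Π1 n a b} {v : Π1 m a b} {u' : Π1 n' b c} {v' : Π1 m' b c}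
                  (f : Path2 P u v) (g : Path2 P u' v') (x : Vec ℕ n) (y : Vec ℕ n') →
                  x ∈ φ₁ u → y ∈ φ₁ u' → φ₂ (f ⋆₀ g) (x ++ y) ≡ φ₂ f x ++ φ₂ g y
    φ₂-⋆₁       : ∀ {n m l a b} {u : Π1 n a b} {v : Π1 m a b} {w : Π1 l a b}
                  (f : Path2 P u v) (g : Path2 P v w) (x : Vec ℕ n) →
                  x ∈ φ₁ u → φ₂ (f ⋆₁ g) x ≡ φ₂ g (φ₂ f x)

record DifferentialInterpretation {P : Polygraph2} (Φ : FunctorialInterpretation P)
         {c ℓ₁ ℓ₂} (M : OrderedCommutativeMonoid c ℓ₁ ℓ₂) : Set (lsuc lzero ⊔ c ⊔ ℓ₁ ⊔ ℓ₂) where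
  open FunctorialInterpretation Φ
  open OrderedCommutativeMonoid M
  private
    Π1 = Path1 (base₁ P)
  field
    ∂      : ∀ {n m a b} {u : Π1 n a b} {v : Π1 m a b} → Path2 P u v → Vec ℕ n → Carrier
    ∂-mono : ∀ {n m a b} {u : Π1 n a b} {v : Π1 m a b} (f : Path2 P u v) (x y : Vec ℕ n) →
             x ∈ φ₁ u → y ∈ φ₁ u → x ≤ᵥ y → ∂ f x ⪯ ∂ f y
    ∂-id   : ∀ {n a b} (u : Π1 n a b) (x : Vec ℕ n) → x ∈ φ₁ u → ∂ (id₂ u) x ≈ 0#
    ∂-⋆₀   : ∀ {n m n' m' a b c} {u : Π1 n a b} {v : Π1 m a b} {u' : Π1 n' b c} {v' : Π1 m' b c}
             (f : Path2 P u v) (g : Path2 P u' v') (x : Vec ℕ n) (y : Vec ℕ n') →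
             x ∈ φ₁ u → y ∈ φ₁ u' → ∂ (f ⋆₀ g) (x ++ y) ≈ ∂ f x + ∂ g y
    ∂-⋆₁   : ∀ {n m l a b} {u : Π1 n a b} {v : Π1 m a b} {w : Π1 l a b}
             (f : Path2 P u v) (g : Path2 P v w) (x : Vec ℕ n) →
             x ∈ φ₁ u → ∂ (f ⋆₁ g) x ≈ ∂ f x + ∂ g (φ₂ f x)

module _ {P : Polygraph2} (Φ : FunctorialInterpretation P) where
  open FunctorialInterpretation Φ

  MapLeq : ∀ {n m a b} (u : Path1 (base₁ P) n a b) → (Vec ℕ n → Vec ℕ m) → (Vec ℕ n → Vec ℕ m) → Set
  MapLeq {n} u F G = ∀ (x : Vec ℕ n) → x ∈ φ₁ u → F x ≤ᵥ G x

  module _ {c ℓ₁ ℓ₂} (M : OrderedCommutativeMonoid c ℓ₁ ℓ₂) where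
    open OrderedCommutativeMonoid M

    DLeq : ∀ {n a b} (u : Path1 (base₁ P) n a b) → (Vec ℕ n → Carrier) → (Vec ℕ n → Carrier) → Set ℓ₂
    DLeq {n} u F G = ∀ (x : Vec ℕ n) → x ∈ φ₁ u → F x ⪯ G x

    DLt : ∀ {n a b} (u : Path1 (base₁ P) n a b) → (Vec ℕ n → Carrier) → (Vec ℕ n → Carrier) → Set (ℓ₁ ⊔ ℓ₂)
    DLt {n} u F G = ∀ (x : Vec ℕ n) → x ∈ φ₁ u → F x ≺ G x

-- Through the composition axioms of ∂, both sides become sums: ∂ f x + ∂ h y for ⋆₀
-- and ∂ f x + ∂ h (φ f x) for ⋆₁. For ⋆₁
-- the second summand is where φ(f) ≤ φ(g) is needed: ∂ h is monotone, so
-- ∂ h (φ f x) ⪯ ∂ h (φ g x) ⪯ ∂ k (φ g x). Monotonicity of + then gives the large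
-- inequality, and strict monotonicity the strict one as soon as one summand
-- comparison is strict.
{-# OPTIONS --safe #-}
module Submission where

open import Defs
open import Level using (Level)
open import Data.Nat using (ℕ) renaming (_+_ to _+ℕ_)
open import Data.Product using (_×_; _,_; proj₁; proj₂)
open import Data.Sum using (_⊎_; inj₁; inj₂)
import Data.Sum as Sum
open import Data.Vec using (Vec; _++_; splitAt)
open import Function using (_∘_)
open import Function.Bundles using (Equivalence)
open import Relation.Unary using (Pred; _∈_)
open import Relation.Binary.Bundles using (Poset)
open import Relation.Binary.PropositionalEquality using (refl)
import Relation.Binary.Reasoning.PartialOrder as PosetReasoning

module OrderedCommutativeMonoidProperties {c ℓ₁ ℓ₂} (M : OrderedCommutativeMonoid c ℓ₁ ℓ₂) where
  open OrderedCommutativeMonoid M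

  poset : Poset c ℓ₁ ℓ₂
  poset = record { isPartialOrder = isPartialOrder }

  open Poset poset using () renaming (refl to ⪯-refl)
  open PosetReasoning poset

  +-mono-≺ : StrictlyOrdered M → ∀ {x y z w} → x ⪯ y → z ⪯ w → x ≺ y ⊎ z ≺ w → x + z ≺ y + w
  +-mono-≺ +-strict {x} {y} {z} {w} x⪯y z⪯w (inj₁ x≺y) = begin-strict
    x + z  <⟨ proj₁ (+-strict x≺y) ⟩
    y + z  ≤⟨ +-mono ⪯-refl z⪯w ⟩
    y + w  ∎
  +-mono-≺ +-strict {x} {y} {z} {w} x⪯y z⪯w (inj₂ z≺w) = begin-strict
    x + z  ≤⟨ +-mono x⪯y ⪯-refl ⟩
    y + z  <⟨ proj₂ (+-strict z≺w) ⟩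
    y + w  ∎

module _ {P : Polygraph2} (Φ : FunctorialInterpretation P) where
  open FunctorialInterpretation Φ

  φ₁-⋆₀-elim : ∀ {ℓ n n' a b d} (u : Path1 (base₁ P) n a b) (u' : Path1 (base₁ P) n' b d)
               {Q : Pred (Vec ℕ (n +ℕ n')) ℓ} →
               (∀ x y → x ∈ φ₁ u → y ∈ φ₁ u' → Q (x ++ y)) →
               ∀ z → z ∈ φ₁ (u ⋆₀¹ u') → Q z
  φ₁-⋆₀-elim {n = n} u u' Q-++ z z∈ with splitAt n z
  ... | x , y , refl = Q-++ x y (proj₁ x,y∈) (proj₂ x,y∈)
    where x,y∈ = Equivalence.to (φ₁-⋆₀ u u' x y) z∈

module DifferentialInterpretationProperties
         {P : Polygraph2} {Φ : FunctorialInterpretation P}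
         {c ℓ₁ ℓ₂} {M : OrderedCommutativeMonoid c ℓ₁ ℓ₂} (D : DifferentialInterpretation Φ M) where
  open FunctorialInterpretation Φ
  open DifferentialInterpretation D
  open OrderedCommutativeMonoid M
  open OrderedCommutativeMonoidProperties M
  open PosetReasoning poset

  private variable
    n : ℕ
    a b : Cell₀ (base₁ P)
    u v w u' v' : Path1 (base₁ P) n a b

  ∂-mono-along-φ₂ : {f g : Path2 P u v} → MapLeq Φ u (φ₂ f) (φ₂ g) →
                     (h : Path2 P v w) → DLeq Φ M u (∂ h ∘ φ₂ f) (∂ h ∘ φ₂ g)
  ∂-mono-along-φ₂ {f = f} {g} φf≤φg h x x∈ =
    ∂-mono h _ _ (φ₂-into f x x∈) (φ₂-into g x x∈) (φf≤φg x x∈)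

  ∂∘φ₂-mono : {f g : Path2 P u v} {h k : Path2 P v w} → MapLeq Φ u (φ₂ f) (φ₂ g) →
              DLeq Φ M v (∂ h) (∂ k) → DLeq Φ M u (∂ h ∘ φ₂ f) (∂ k ∘ φ₂ g)
  ∂∘φ₂-mono {f = f} {g} {h} {k} φf≤φg ∂h⪯∂k x x∈ = begin
    ∂ h (φ₂ f x)  ≤⟨ ∂-mono-along-φ₂ φf≤φg h x x∈ ⟩
    ∂ h (φ₂ g x)  ≤⟨ ∂h⪯∂k (φ₂ g x) (φ₂-into g x x∈) ⟩
    ∂ k (φ₂ g x)  ∎

  ∂∘φ₂-strictMono : {f g : Path2 P u v} {h k : Path2 P v w} → MapLeq Φ u (φ₂ f) (φ₂ g) →
                    DLt Φ M v (∂ h) (∂ k) → DLt Φ M u (∂ h ∘ φ₂ f) (∂ k ∘ φ₂ g)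
  ∂∘φ₂-strictMono {f = f} {g} {h} {k} φf≤φg ∂h≺∂k x x∈ = begin-strict
    ∂ h (φ₂ f x)  ≤⟨ ∂-mono-along-φ₂ φf≤φg h x x∈ ⟩
    ∂ h (φ₂ g x)  <⟨ ∂h≺∂k (φ₂ g x) (φ₂-into g x x∈) ⟩
    ∂ k (φ₂ g x)  ∎

  ∂-⋆₀-mono : {f g : Path2 P u v} {h k : Path2 P u' v'} →
              DLeq Φ M u (∂ f) (∂ g) → DLeq Φ M u' (∂ h) (∂ k) →
              DLeq Φ M (u ⋆₀¹ u') (∂ (f ⋆₀ h)) (∂ (g ⋆₀ k))
  ∂-⋆₀-mono {f = f} {g} {h} {k} ∂f⪯∂g ∂h⪯∂k = φ₁-⋆₀-elim Φ _ _ λ x y x∈ y∈ → begin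
    ∂ (f ⋆₀ h) (x ++ y)  ≈⟨ ∂-⋆₀ f h x y x∈ y∈ ⟩
    ∂ f x + ∂ h y        ≤⟨ +-mono (∂f⪯∂g x x∈) (∂h⪯∂k y y∈) ⟩
    ∂ g x + ∂ k y        ≈⟨ ∂-⋆₀ g k x y x∈ y∈ ⟨
    ∂ (g ⋆₀ k) (x ++ y)  ∎

  ∂-⋆₀-strictMono : StrictlyOrdered M → {f g : Path2 P u v} {h k : Path2 P u' v'} →
                    DLeq Φ M u (∂ f) (∂ g) → DLeq Φ M u' (∂ h) (∂ k) →
                    DLt Φ M u (∂ f) (∂ g) ⊎ DLt Φ M u' (∂ h) (∂ k) →
                    DLt Φ M (u ⋆₀¹ u') (∂ (f ⋆₀ h)) (∂ (g ⋆₀ k))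
  ∂-⋆₀-strictMono +-strict {f = f} {g} {h} {k} ∂f⪯∂g ∂h⪯∂k one-strict =
    φ₁-⋆₀-elim Φ _ _ λ x y x∈ y∈ → begin-strict
      ∂ (f ⋆₀ h) (x ++ y)  ≈⟨ ∂-⋆₀ f h x y x∈ y∈ ⟩
      ∂ f x + ∂ h y        <⟨ +-mono-≺ +-strict (∂f⪯∂g x x∈) (∂h⪯∂k y y∈)
                                (Sum.map (λ ∂f≺∂g → ∂f≺∂g x x∈) (λ ∂h≺∂k → ∂h≺∂k y y∈) one-strict) ⟩
      ∂ g x + ∂ k y        ≈⟨ ∂-⋆₀ g k x y x∈ y∈ ⟨
      ∂ (g ⋆₀ k) (x ++ y)  ∎

  ∂-⋆₁-mono : {f g : Path2 P u v} {h k : Path2 P v w} → MapLeq Φ u (φ₂ f) (φ₂ g) →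
              DLeq Φ M u (∂ f) (∂ g) → DLeq Φ M v (∂ h) (∂ k) →
              DLeq Φ M u (∂ (f ⋆₁ h)) (∂ (g ⋆₁ k))
  ∂-⋆₁-mono {f = f} {g} {h} {k} φf≤φg ∂f⪯∂g ∂h⪯∂k x x∈ = begin
    ∂ (f ⋆₁ h) x              ≈⟨ ∂-⋆₁ f h x x∈ ⟩
    ∂ f x + ∂ h (φ₂ f x)      ≤⟨ +-mono (∂f⪯∂g x x∈) (∂∘φ₂-mono φf≤φg ∂h⪯∂k x x∈) ⟩
    ∂ g x + ∂ k (φ₂ g x)      ≈⟨ ∂-⋆₁ g k x x∈ ⟨
    ∂ (g ⋆₁ k) x              ∎

  ∂-⋆₁-strictMono : StrictlyOrdered M → {f g : Path2 P u v} {h k : Path2 P v w} →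
                    MapLeq Φ u (φ₂ f) (φ₂ g) →
                    DLeq Φ M u (∂ f) (∂ g) → DLeq Φ M v (∂ h) (∂ k) →
                    DLt Φ M u (∂ f) (∂ g) ⊎ DLt Φ M v (∂ h) (∂ k) →
                    DLt Φ M u (∂ (f ⋆₁ h)) (∂ (g ⋆₁ k))
  ∂-⋆₁-strictMono +-strict {f = f} {g} {h} {k} φf≤φg ∂f⪯∂g ∂h⪯∂k one-strict x x∈ = begin-strict
    ∂ (f ⋆₁ h) x              ≈⟨ ∂-⋆₁ f h x x∈ ⟩
    ∂ f x + ∂ h (φ₂ f x)      <⟨ +-mono-≺ +-strict (∂f⪯∂g x x∈) (∂∘φ₂-mono φf≤φg ∂h⪯∂k x x∈)
                                   (Sum.map (λ ∂f≺∂g → ∂f≺∂g x x∈)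
                                            (λ ∂h≺∂k → ∂∘φ₂-strictMono φf≤φg ∂h≺∂k x x∈) one-strict) ⟩
    ∂ g x + ∂ k (φ₂ g x)      ≈⟨ ∂-⋆₁ g k x x∈ ⟨
    ∂ (g ⋆₁ k) x              ∎

lemma2p18 : ∀ {c ℓ₁ ℓ₂ : Level} (Π : Polygraph3) (Φ : FunctorialInterpretation (base₂ Π))
    (M : OrderedCommutativeMonoid c ℓ₁ ℓ₂) (D : DifferentialInterpretation Φ M) →
    let P = base₂ Π
        open FunctorialInterpretation Φ
        open DifferentialInterpretation D
    in ∀ {n m a b} {u : Path1 (base₁ P) n a b} {v : Path1 (base₁ P) m a b}
       (f g : Path2 P u v) →
       MapLeq Φ u (φ₂ f) (φ₂ g) →
       DLeq Φ M u (∂ f) (∂ g) →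
       -- case i = 0
       (∀ {n' m' d} {u' : Path1 (base₁ P) n' b d} {v' : Path1 (base₁ P) m' b d}
          (h k : Path2 P u' v') →
          DLeq Φ M u' (∂ h) (∂ k) →
          DLeq Φ M (u ⋆₀¹ u') (∂ (f ⋆₀ h)) (∂ (g ⋆₀ k))
          × (StrictlyOrdered M →
             DLt Φ M u (∂ f) (∂ g) ⊎ DLt Φ M u' (∂ h) (∂ k) →
             DLt Φ M (u ⋆₀¹ u') (∂ (f ⋆₀ h)) (∂ (g ⋆₀ k))))
       ×
       -- case i = 1
       (∀ {l} {w : Path1 (base₁ P) l a b}
          (h k : Path2 P v w) →
          DLeq Φ M v (∂ h) (∂ k) →
          DLeq Φ M u (∂ (f ⋆₁ h)) (∂ (g ⋆₁ k))
          × (StrictlyOrdered M →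
             DLt Φ M u (∂ f) (∂ g) ⊎ DLt Φ M v (∂ h) (∂ k) →
             DLt Φ M u (∂ (f ⋆₁ h)) (∂ (g ⋆₁ k))))
lemma2p18 Π Φ M D f g φf≤φg ∂f⪯∂g =
    (λ h k ∂h⪯∂k → ∂-⋆₀-mono ∂f⪯∂g ∂h⪯∂k
                 , λ +-strict → ∂-⋆₀-strictMono +-strict ∂f⪯∂g ∂h⪯∂k)
  , (λ h k ∂h⪯∂k → ∂-⋆₁-mono φf≤φg ∂f⪯∂g ∂h⪯∂k
                 , λ +-strict → ∂-⋆₁-strictMono +-strict φf≤φg ∂f⪯∂g ∂h⪯∂k)
  where open DifferentialInterpretationProperties D
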